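{- Let $k>1$ and $\ell>2$ be integers and let $\mathcal L$ be a mixed layout of $G(k,\ell)$. Then there is no smiley face in $\mathcal L$ all of whose six vertices are vertices of $G(k-1,\ell)$ (and whose four edges are edges of $G(k-1,\ell)$).
   Context: For $\ell\ge 1$, $G(1,\ell)$ is a single edge; for $k>1$, $G(k,\ell)$ is obtained from $G(k-1,\ell)$ by attaching $\ell$ new vertices to each edge of $G(k-1,\ell)$, where attaching a new vertex $u$ to an edge $(v,w)$ means adding $u$ and the edges $(u,v),(u,w)$. A linear order is a total order $\prec$ of the vertex set. Two independent edges $(u_1,v_1),(u_2,v_2)$ with $u_i\prec v_i$ cross if $u_1\prec u_2\prec v_1\prec v_2$ and nest if $u_1\prec u_2\prec v_2\prec v_1$. A stack is a set of pairwise non-crossing edges; a queue is a set of pairwise non-nested edges. A mixed layout consists of a linear order of the vertices and a partition of the edges into one stack and one queue; edges in the stack (queue) are stack-edges (queue-edges). A smiley face $\langle a,b,u,v,c,d\rangle$ in a mixed layout consists of six vertices with $a\prec b\prec u\prec v\prec c\prec d$ and four edges $(a,b),(c,d),(a,d),(u,v)$ such that $(a,b),(c,d),(a,d)$ are queue-edges and $(u,v)$ is a stack-edge. -}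

module Defs where

open import Data.Nat using (ℕ; zero; suc; _+_; _*_; _<_)
open import Data.Bool using (Bool; true; false)
open import Data.Product using (_×_; _,_; Σ-syntax)
open import Data.Sum using (_⊎_)
open import Data.List using (List; []; _∷_; _++_; length)
open import Data.List.Membership.Propositional using (_∈_)
open import Relation.Binary.PropositionalEquality using (_≡_)
open import Relation.Nullary using (¬_)

-- A graph: vertices are the natural numbers 0 .. nv-1, edges are a list of
-- (unordered) pairs, stored as ordered pairs.
record Graph : Set where
  constructor mkGraph
  field
    nv    : ℕ
    edges : List (ℕ × ℕ)
open Graph public

attachOne : ℕ → ℕ → ℕ × ℕ → List (ℕ × ℕ)
attachOne zero    n e       = []
attachOne (suc i) n (v , w) = (n , v) ∷ (n , w) ∷ attachOne i (suc n) (v , w)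

attachAll : ℕ → ℕ → List (ℕ × ℕ) → List (ℕ × ℕ)
attachAll ℓ n []       = []
attachAll ℓ n (e ∷ es) = attachOne ℓ n e ++ attachAll ℓ (n + ℓ) es

step : ℕ → Graph → Graph
step ℓ (mkGraph n es) = mkGraph (n + ℓ * length es) (es ++ attachAll ℓ n es)

-- Gs k ℓ is the paper's G(k+1, ℓ)  (index shifted so that k ≥ 1 is built in)
Gs : ℕ → ℕ → Graph
Gs zero    ℓ = mkGraph 2 ((0 , 1) ∷ [])
Gs (suc k) ℓ = step ℓ (Gs k ℓ)

Endpoints : ℕ × ℕ → ℕ → ℕ → Set
Endpoints e x y = (e ≡ (x , y)) ⊎ (e ≡ (y , x))

Crosses : (ℕ → ℕ) → ℕ × ℕ → ℕ × ℕ → Set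
Crosses pos e f = Σ[ u₁ ∈ ℕ ] Σ[ v₁ ∈ ℕ ] Σ[ u₂ ∈ ℕ ] Σ[ v₂ ∈ ℕ ]
  (Endpoints e u₁ v₁ × Endpoints f u₂ v₂ ×
   pos u₁ < pos u₂ × pos u₂ < pos v₁ × pos v₁ < pos v₂)

Nests : (ℕ → ℕ) → ℕ × ℕ → ℕ × ℕ → Set
Nests pos e f = Σ[ u₁ ∈ ℕ ] Σ[ v₁ ∈ ℕ ] Σ[ u₂ ∈ ℕ ] Σ[ v₂ ∈ ℕ ]
  (Endpoints e u₁ v₁ × Endpoints f u₂ v₂ ×
   pos u₁ < pos u₂ × pos u₂ < pos v₂ × pos v₂ < pos v₁)

-- mixed layout: linear order of the vertices + partition of edges into one
-- stack (inStack e ≡ true) and one queue (inStack e ≡ false)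
record MixedLayout (G : Graph) : Set where
  field
    pos      : ℕ → ℕ
    pos-inj  : ∀ x y → x < nv G → y < nv G → pos x ≡ pos y → x ≡ y
    inStack  : ℕ × ℕ → Bool
    stack-ok : ∀ e f → e ∈ edges G → f ∈ edges G →
               inStack e ≡ true → inStack f ≡ true → ¬ Crosses pos e f
    queue-ok : ∀ e f → e ∈ edges G → f ∈ edges G →
               inStack e ≡ false → inStack f ≡ false → ¬ Nests pos e f
open MixedLayout public

LayoutEdge : (G H : Graph) → MixedLayout G → Bool → ℕ → ℕ → Set
LayoutEdge G H L b x y = Σ[ e ∈ ℕ × ℕ ]
  (e ∈ edges G × e ∈ edges H × Endpoints e x y × inStack L e ≡ b)

SmileyIn : (G H : Graph) → MixedLayout G → Set
SmileyIn G H L = Σ[ a ∈ ℕ ] Σ[ b ∈ ℕ ] Σ[ u ∈ ℕ ] Σ[ v ∈ ℕ ] Σ[ c ∈ ℕ ] Σ[ d ∈ ℕ ]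
  ( (a < nv H × b < nv H × u < nv H × v < nv H × c < nv H × d < nv H)
  × (pos L a < pos L b × pos L b < pos L u × pos L u < pos L v ×
     pos L v < pos L c × pos L c < pos L d)
  × LayoutEdge G H L false a b × LayoutEdge G H L false c d
  × LayoutEdge G H L false a d × LayoutEdge G H L true u v )

{-# OPTIONS --safe #-}
module Submission where

-- The edge uv of the smiley face lies in G(k-1, ℓ), so G(k, ℓ) has at least three fresh vertices w adjacent
-- to both u and v. Since u and v sit strictly between b and c, a queue edge
-- wu or wv would nest with one of the queue edges ab, cd, ad; hence all these
-- edges are stack edges. But the stack then contains K_{2,3}, which has no
-- one-page book embedding: of two common neighbours of u and v, exactly one
-- can lie between u and v.

open import Defs
open import Data.Nat using (ℕ; zero; suc; _+_; _*_; _<_; _≤_; s≤s; z<s; s<s)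
open import Data.Nat.Properties
open import Data.Bool using (Bool; true; false)
open import Data.Bool.Properties using (¬-not; not-injective)
open import Data.Product using (_×_; _,_; Σ-syntax; map; swap)
open import Data.Sum using (_⊎_; inj₁; inj₂)
open import Data.Empty using (⊥; ⊥-elim)
open import Data.List using (_∷_; length)
open import Data.List.Membership.Propositional using (_∈_)
open import Data.List.Membership.Propositional.Properties using (∈-++⁺ˡ; ∈-++⁺ʳ)
open import Data.List.Relation.Binary.Subset.Propositional using (_⊆_)
open import Data.List.Relation.Unary.Any using (here; there)
open import Function using (_∘_)
open import Relation.Binary using (tri<; tri≈; tri>)
open import Relation.Binary.PropositionalEquality using (_≡_; _≢_; refl; sym; trans; cong; subst)
open import Relation.Nullary using (¬_)

≢⇒<⊎> : ∀ {m n} → m ≢ n → m < n ⊎ n < m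
≢⇒<⊎> {m} {n} m≢n with <-cmp m n
... | tri< m<n _ _ = inj₁ m<n
... | tri≈ _ m≡n _ = ⊥-elim (m≢n m≡n)
... | tri> _ _ n<m = inj₂ n<m

no-three-distinct-bools : ∀ {x y z : Bool} → x ≢ y → x ≢ z → y ≢ z → ⊥
no-three-distinct-bools x≢y x≢z y≢z =
  y≢z (not-injective (trans (sym (¬-not x≢y)) (¬-not x≢z)))

CommonNeighbour : Graph → ℕ → ℕ → ℕ → Set
CommonNeighbour G w u v = (w , u) ∈ edges G × (w , v) ∈ edges G

attachOne-neighbours : ∀ ℓ m v w {i} → i < ℓ →
  (i + m , v) ∈ attachOne ℓ m (v , w) × (i + m , w) ∈ attachOne ℓ m (v , w)
attachOne-neighbours (suc ℓ) m v w {zero}  _          = here refl , there (here refl)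
attachOne-neighbours (suc ℓ) m v w {suc i} (s≤s i<ℓ) =
  map shift shift (attachOne-neighbours ℓ (suc m) v w i<ℓ)
  where
  shift : ∀ {x} → (i + suc m , x) ∈ attachOne ℓ (suc m) (v , w) →
          (suc i + m , x) ∈ attachOne (suc ℓ) m (v , w)
  shift {x} = there ∘ there ∘ subst (λ y → (y , x) ∈ attachOne ℓ (suc m) (v , w)) (+-suc i m)

attachOne⊆attachAll : ∀ ℓ n {es e} → e ∈ es →
  Σ[ m ∈ ℕ ] (n ≤ m × m + ℓ ≤ n + ℓ * length es × attachOne ℓ m e ⊆ attachAll ℓ n es)
attachOne⊆attachAll ℓ n {e ∷ es} (here refl) =
  n , ≤-refl , +-monoʳ-≤ n (m≤m*n ℓ (suc (length es))) , ∈-++⁺ˡ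
attachOne⊆attachAll ℓ n {f ∷ es} (there e∈es)
  with attachOne⊆attachAll ℓ (n + ℓ) e∈es
... | m , n+ℓ≤m , m+ℓ≤ , sub =
  m , ≤-trans (m≤m+n n ℓ) n+ℓ≤m , ≤-trans m+ℓ≤ (≤-reflexive bound) ,
  ∈-++⁺ʳ (attachOne ℓ n f) ∘ sub
  where
  bound : n + ℓ + ℓ * length es ≡ n + ℓ * suc (length es)
  bound = trans (+-assoc n ℓ _) (cong (n +_) (sym (*-suc ℓ (length es))))

step-new-neighbours : ∀ ℓ H {e u v} → e ∈ edges H → Endpoints e u v →
  Σ[ m ∈ ℕ ] (∀ {i} → i < ℓ →
    nv H ≤ i + m × i + m < nv (step ℓ H) × CommonNeighbour (step ℓ H) (i + m) u v)
step-new-neighbours ℓ H {e} {u} {v} e∈H ends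
  with attachOne⊆attachAll ℓ (nv H) e∈H
... | m , H≤m , m+ℓ≤ , sub = m , λ i<ℓ →
  ≤-trans H≤m (m≤n+m m _) ,
  <-≤-trans (subst (_< m + ℓ) (+-comm m _) (+-monoʳ-< m i<ℓ)) m+ℓ≤ ,
  neighbours ends i<ℓ
  where
  new : ∀ {x} → x ∈ attachOne ℓ m e → x ∈ edges (step ℓ H)
  new = ∈-++⁺ʳ (edges H) ∘ sub
  neighbours : Endpoints e u v → ∀ {i} → i < ℓ → CommonNeighbour (step ℓ H) (i + m) u v
  neighbours (inj₁ refl) i<ℓ = map new new (attachOne-neighbours ℓ m u v i<ℓ)
  neighbours (inj₂ refl) i<ℓ = swap (map new new (attachOne-neighbours ℓ m v u i<ℓ))

module OneStack (pos : ℕ → ℕ) (S : ℕ × ℕ → Set)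
                (non-crossing : ∀ e f → S e → S f → ¬ Crosses pos e f)
                {lo hi : ℕ} (lo<hi : pos lo < pos hi) where

  Joined : ℕ → Set
  Joined w = S (w , lo) × S (w , hi)

  data Region (w : ℕ) : Set where
    left   : pos w < pos lo → Region w
    middle : pos lo < pos w → pos w < pos hi → Region w
    right  : pos hi < pos w → Region w

  region : ∀ {w} → pos w ≢ pos lo → pos w ≢ pos hi → Region w
  region w≢lo w≢hi with ≢⇒<⊎> w≢lo
  ... | inj₁ w<lo = left w<lo
  ... | inj₂ lo<w with ≢⇒<⊎> w≢hi
  ...   | inj₁ w<hi = middle lo<w w<hi
  ...   | inj₂ hi<w = right hi<w

  isMiddle : ∀ {w} → Region w → Bool
  isMiddle (middle _ _) = true
  isMiddle _            = false

  both-left : ∀ {w₁ w₂} → pos w₁ < pos w₂ → pos w₂ < pos lo → Joined w₁ → Joined w₂ → ⊥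
  both-left w₁<w₂ w₂<lo (w₁lo , _) (_ , w₂hi) = non-crossing _ _ w₁lo w₂hi
    (_ , _ , _ , _ , inj₁ refl , inj₁ refl , w₁<w₂ , w₂<lo , lo<hi)

  both-middle : ∀ {w₁ w₂} → pos lo < pos w₁ → pos w₁ < pos w₂ → pos w₂ < pos hi →
                Joined w₁ → Joined w₂ → ⊥
  both-middle lo<w₁ w₁<w₂ w₂<hi (_ , w₁hi) (w₂lo , _) = non-crossing _ _ w₂lo w₁hi
    (_ , _ , _ , _ , inj₂ refl , inj₁ refl , lo<w₁ , w₁<w₂ , w₂<hi)

  both-right : ∀ {w₁ w₂} → pos hi < pos w₁ → pos w₁ < pos w₂ → Joined w₁ → Joined w₂ → ⊥
  both-right hi<w₁ w₁<w₂ (w₁lo , _) (_ , w₂hi) = non-crossing _ _ w₁lo w₂hi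
    (_ , _ , _ , _ , inj₂ refl , inj₂ refl , lo<hi , hi<w₁ , w₁<w₂)

  left-right : ∀ {w₁ w₂} → pos w₁ < pos lo → pos hi < pos w₂ → Joined w₁ → Joined w₂ → ⊥
  left-right w₁<lo hi<w₂ (_ , w₁hi) (w₂lo , _) = non-crossing _ _ w₁hi w₂lo
    (_ , _ , _ , _ , inj₁ refl , inj₂ refl , w₁<lo , lo<hi , hi<w₂)

  joined-pair : ∀ {w₁ w₂} → pos w₁ ≢ pos w₂ → (r₁ : Region w₁) (r₂ : Region w₂) →
                Joined w₁ → Joined w₂ → isMiddle r₁ ≢ isMiddle r₂
  joined-pair w₁≢w₂ (left p) (left q) j₁ j₂ _ with ≢⇒<⊎> w₁≢w₂
  ... | inj₁ w₁<w₂ = both-left w₁<w₂ q j₁ j₂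
  ... | inj₂ w₂<w₁ = both-left w₂<w₁ p j₂ j₁
  joined-pair w₁≢w₂ (middle p p′) (middle q q′) j₁ j₂ _ with ≢⇒<⊎> w₁≢w₂
  ... | inj₁ w₁<w₂ = both-middle p w₁<w₂ q′ j₁ j₂
  ... | inj₂ w₂<w₁ = both-middle q w₂<w₁ p′ j₂ j₁
  joined-pair w₁≢w₂ (right p) (right q) j₁ j₂ _ with ≢⇒<⊎> w₁≢w₂
  ... | inj₁ w₁<w₂ = both-right p w₁<w₂ j₁ j₂
  ... | inj₂ w₂<w₁ = both-right q w₂<w₁ j₂ j₁
  joined-pair _ (left p)  (right q) j₁ j₂ _ = left-right p q j₁ j₂
  joined-pair _ (right p) (left q)  j₁ j₂ _ = left-right q p j₂ j₁
  joined-pair _ (left _)     (middle _ _) _ _ ()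
  joined-pair _ (middle _ _) (left _)     _ _ ()
  joined-pair _ (middle _ _) (right _)    _ _ ()
  joined-pair _ (right _)    (middle _ _) _ _ ()

  Outside : ℕ → Set
  Outside w = pos w ≢ pos lo × pos w ≢ pos hi

  no-three-joined : ∀ {w₁ w₂ w₃} →
    pos w₁ ≢ pos w₂ → pos w₁ ≢ pos w₃ → pos w₂ ≢ pos w₃ →
    Outside w₁ → Outside w₂ → Outside w₃ → Joined w₁ → Joined w₂ → Joined w₃ → ⊥
  no-three-joined w₁≢w₂ w₁≢w₃ w₂≢w₃ (o₁ , o₁′) (o₂ , o₂′) (o₃ , o₃′) j₁ j₂ j₃ =
    no-three-distinct-bools (joined-pair w₁≢w₂ r₁ r₂ j₁ j₂)
                            (joined-pair w₁≢w₃ r₁ r₃ j₁ j₃)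
                            (joined-pair w₂≢w₃ r₂ r₃ j₂ j₃)
    where
    r₁ = region o₁ o₁′
    r₂ = region o₂ o₂′
    r₃ = region o₃ o₃′

QueueEdge : (G : Graph) → MixedLayout G → ℕ → ℕ → Set
QueueEdge G L x y = Σ[ e ∈ ℕ × ℕ ] (e ∈ edges G × Endpoints e x y × inStack L e ≡ false)

module _ {G : Graph} (L : MixedLayout G) where

  private
    P : ℕ → ℕ
    P = pos L

  inStack-inside-queue-frame : ∀ {a b c d w z} →
    QueueEdge G L a b → QueueEdge G L c d → QueueEdge G L a d →
    P a < P b → P b < P z → P z < P c → P c < P d →
    (w , z) ∈ edges G → P w ≢ P a → P w ≢ P z → P w ≢ P d → inStack L (w , z) ≡ true
  inStack-inside-queue-frame {a} {b} {c} {d} {w} {z}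
    (eab , eab∈ , ab , ab-queue) (ecd , ecd∈ , cd , cd-queue) (ead , ead∈ , ad , ad-queue)
    a<b b<z z<c c<d wz∈ w≢a w≢z w≢d
    with inStack L (w , z) in wz-status
  ... | true  = refl
  ... | false = ⊥-elim nested
    where
    nested : ⊥
    nested with ≢⇒<⊎> w≢a
    ... | inj₁ w<a = queue-ok L _ _ wz∈ eab∈ wz-status ab-queue
      (w , z , a , b , inj₁ refl , ab , w<a , a<b , b<z)
    ... | inj₂ a<w with ≢⇒<⊎> w≢d
    ...   | inj₂ d<w = queue-ok L _ _ wz∈ ecd∈ wz-status cd-queue
      (z , w , c , d , inj₂ refl , cd , z<c , c<d , d<w)
    ...   | inj₁ w<d with ≢⇒<⊎> w≢z
    ...     | inj₁ w<z = queue-ok L _ _ ead∈ wz∈ ad-queue wz-status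
      (a , d , w , z , ad , inj₁ refl , a<w , w<z , <-trans z<c c<d)
    ...     | inj₂ z<w = queue-ok L _ _ ead∈ wz∈ ad-queue wz-status
      (a , d , z , w , ad , inj₂ refl , <-trans a<b b<z , z<w , w<d)

no-smiley-after-step : ∀ ℓ H → 2 < ℓ → (L : MixedLayout (step ℓ H)) →
  ¬ SmileyIn (step ℓ H) H L
no-smiley-after-step ℓ H 2<ℓ L
  (a , b , u , v , c , d , (a∈ , _ , u∈ , v∈ , _ , d∈) , (a<b , b<u , u<v , v<c , c<d) ,
   ab , cd , ad , (e , _ , e∈H , uv , _))
  with step-new-neighbours ℓ H e∈H uv
... | m , fresh =
  no-three-joined (fresh≢fresh 0<3 1<3 λ ()) (fresh≢fresh 0<3 2<3 λ ()) (fresh≢fresh 1<3 2<3 λ ())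
                  (outside 0<3) (outside 1<3) (outside 2<3) (joined 0<3) (joined 1<3) (joined 2<3)
  where
  G = step ℓ H
  0<3 : 0 < 3
  0<3 = z<s
  1<3 : 1 < 3
  1<3 = s<s z<s
  2<3 : 2 < 3
  2<3 = s<s (s<s z<s)
  queue : ∀ {x y} → LayoutEdge G H L false x y → QueueEdge G L x y
  queue (f , f∈G , _ , ends , status) = f , f∈G , ends , status
  open OneStack (pos L) (λ f → f ∈ edges G × inStack L f ≡ true)
                (λ f g (f∈ , f-stack) (g∈ , g-stack) → stack-ok L f g f∈ g∈ f-stack g-stack)
                u<v

  fresh-vertex : ∀ {i} → i < 3 → nv H ≤ i + m × i + m < nv G × CommonNeighbour G (i + m) u v
  fresh-vertex i<3 = fresh (<-≤-trans i<3 2<ℓ)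

  old-vertex : ∀ {x} → x < nv H → x < nv G
  old-vertex x< = <-≤-trans x< (m≤m+n (nv H) _)

  position-injective : ∀ {x y} → x < nv G → y < nv G → x ≢ y → pos L x ≢ pos L y
  position-injective x< y< x≢y = x≢y ∘ pos-inj L _ _ x< y<

  fresh≢fresh : ∀ {i j} → i < 3 → j < 3 → i ≢ j → pos L (i + m) ≢ pos L (j + m)
  fresh≢fresh i<3 j<3 i≢j with fresh-vertex i<3 | fresh-vertex j<3
  ... | _ , i+m< , _ | _ , j+m< , _ =
    position-injective i+m< j+m< (i≢j ∘ +-cancelʳ-≡ m _ _)

  fresh≢old : ∀ {i x} → i < 3 → x < nv H → pos L (i + m) ≢ pos L x
  fresh≢old i<3 x< with fresh-vertex i<3
  ... | H≤i+m , i+m< , _ =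
    position-injective i+m< (old-vertex x<) (<⇒≢ (<-≤-trans x< H≤i+m) ∘ sym)

  outside : ∀ {i} → i < 3 → Outside (i + m)
  outside i<3 = fresh≢old i<3 u∈ , fresh≢old i<3 v∈

  joined : ∀ {i} → i < 3 → Joined (i + m)
  joined i<3 with fresh-vertex i<3
  ... | _ , _ , wu∈ , wv∈ =
    (wu∈ , inStack-inside-queue-frame L (queue ab) (queue cd) (queue ad) a<b b<u (<-trans u<v v<c) c<d
             wu∈ (fresh≢old i<3 a∈) (fresh≢old i<3 u∈) (fresh≢old i<3 d∈)) ,
    (wv∈ , inStack-inside-queue-frame L (queue ab) (queue cd) (queue ad) a<b (<-trans b<u u<v) v<c c<d
             wv∈ (fresh≢old i<3 a∈) (fresh≢old i<3 v∈) (fresh≢old i<3 d∈))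

lemma2 : ∀ (j ℓ : ℕ) → 2 < ℓ → (L : MixedLayout (Gs (suc j) ℓ)) →
           ¬ SmileyIn (Gs (suc j) ℓ) (Gs j ℓ) L
lemma2 j ℓ 2<ℓ = no-smiley-after-step ℓ (Gs j ℓ) 2<ℓ
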